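{- Let $n\ge1$ and $d$ be integers with $|d|\geq2$. The sandpile group (equivalently, the critical group) of the generalized de Bruijn graph $\mathrm{DB}(n,d)$ if $d>0$, respectively of the generalized Kautz graph $\mathrm{Ktz}(n,|d|)$ if $d<0$, is isomorphic to $\mathcal Z_n/\langle f_v\mid 1\le v\le n-1\rangle_{\mathbb{Z}}$.
   Context: $\mathrm{DB}(n,d)$: vertex set $\mathbb{Z}_n$, arcs $v\to dv+i$ ($0\le i\le d-1$); $\mathrm{Ktz}(n,d)$: vertex set $\mathbb{Z}_n$, arcs $v\to -d(v+1)+i$ ($0\le i\le d-1$). The critical group is the torsion subgroup of $\mathbb{Z}^n/\mathbb{Z}^n\Delta$, with $\Delta=D-A$ the Laplacian (out-degree diagonal minus adjacency matrix); the sandpile group at $v$ is the torsion subgroup of the analogous quotient for the reduced Laplacian (row and column $v$ removed); both graphs are Eulerian, so these coincide. In $\mathbb{Z}[x,x^{ -1}]/(x^n-1)$: $f_v=dx^v-\sum_{i=0}^{d-1}x^{dv+i}$ for $d>0$ and $f_v=dx^v+\sum_{i=0}^{|d|-1}x^{d(v+1)+i}$ for $d<0$; $\mathcal Z_n$ is the $\mathbb{Z}$-span of $x^v-1$, $1\le v\le n-1$. -}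

module Defs where

open import Data.Nat.Base as ℕ using (ℕ; zero; suc; NonZero)
open import Data.Integer.Base using (ℤ; +_; -[1+_]; _+_; _*_; -_; _-_; 0ℤ; 1ℤ; _%ℕ_)
open import Data.Integer.DivMod using (n%ℕd<d)
open import Data.Fin.Base using (Fin; zero; suc; toℕ; fromℕ<; punchIn)
open import Data.Fin.Properties using (_≟_)
open import Data.Bool.Base using (if_then_else_)
open import Relation.Nullary.Decidable.Core using (does)
open import Data.Product.Base using (Σ; ∃; _×_)
open import Relation.Binary.PropositionalEquality using (_≡_)

Vecℤ : ℕ → Set
Vecℤ k = Fin k → ℤ

_⊕_ : ∀ {k} → Vecℤ k → Vecℤ k → Vecℤ k
(x ⊕ y) j = x j + y j

_⊖_ : ∀ {k} → Vecℤ k → Vecℤ k → Vecℤ k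
(x ⊖ y) j = x j - y j

_•_ : ∀ {k} → ℤ → Vecℤ k → Vecℤ k
(c • x) j = c * x j

∑ : ∀ {k} → (Fin k → ℤ) → ℤ
∑ {zero}  f = 0ℤ
∑ {suc k} f = f zero + ∑ (λ i → f (suc i))

InSpan : ∀ {r k} → (Fin r → Vecℤ k) → Vecℤ k → Set
InSpan {r} g x = Σ (Fin r → ℤ) λ c → ∀ j → x j ≡ ∑ (λ i → c i * g i j)

-- Abelian groups presented as subquotients  S / ⟨rel⟩  with S ⊆ ℤ^k

record SubQuot (k : ℕ) : Set₁ where
  field
    Sub  : Vecℤ k → Set
    nrel : ℕ
    rel  : Fin nrel → Vecℤ k

  _≈_ : Vecℤ k → Vecℤ k → Set
  x ≈ y = InSpan rel (x ⊖ y)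

record _≅_ {k k′ : ℕ} (A : SubQuot k) (B : SubQuot k′) : Set where
  private
    module A = SubQuot A
    module B = SubQuot B
  field
    to      : (x : Vecℤ k) → A.Sub x → Vecℤ k′
    to-Sub  : ∀ x px → B.Sub (to x px)
    to-cong : ∀ x y px py → x A.≈ y → to x px B.≈ to y py
    to-hom  : ∀ x y px py pxy → to (x ⊕ y) pxy B.≈ (to x px ⊕ to y py)
    to-inj  : ∀ x y px py → to x px B.≈ to y py → x A.≈ y
    to-surj : ∀ z → B.Sub z → Σ (Vecℤ k) λ x → Σ (A.Sub x) λ px → to x px B.≈ z

-- digraphs on ℤ_n with constant out-degree e, given by arc targets

idx : (n : ℕ) .{{_ : NonZero n}} → ℤ → Fin n
idx n a = fromℕ< (n%ℕd<d a n)

vtx : ∀ {n} → Fin n → ℤ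
vtx v = + toℕ v

DB : (n : ℕ) .{{_ : NonZero n}} (e : ℕ) → Fin n → Fin e → Fin n
DB n e v i = idx n (+ e * vtx v + + toℕ i)

Ktz : (n : ℕ) .{{_ : NonZero n}} (e : ℕ) → Fin n → Fin e → Fin n
Ktz n e v i = idx n (- (+ e * (vtx v + 1ℤ)) + + toℕ i)

δ : ∀ {n} → Fin n → Fin n → ℤ
δ v w = if does (v ≟ w) then 1ℤ else 0ℤ

Laplacian : ∀ {n} (e : ℕ) → (Fin n → Fin e → Fin n) → Fin n → Vecℤ n
Laplacian e arc v w = + e * δ v w - ∑ (λ i → δ (arc v i) w)

-- critical group: torsion subgroup of ℤ^n / ℤ^n Δ
Torsion : ∀ {r k} → (Fin r → Vecℤ k) → Vecℤ k → Set
Torsion g x = Σ ℕ λ m → Σ (NonZero m) λ _ → InSpan g ((+ m) • x)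

CriticalGroup : ∀ {n} (e : ℕ) → (Fin n → Fin e → Fin n) → SubQuot n
CriticalGroup {n} e arc = record
  { Sub = Torsion (Laplacian e arc) ; nrel = n ; rel = Laplacian e arc }

-- reduced Laplacian at v (row and column v removed); sandpile group at v
ReducedLaplacian : ∀ {m} (e : ℕ) → (Fin (suc m) → Fin e → Fin (suc m)) →
                   Fin (suc m) → Fin m → Vecℤ m
ReducedLaplacian e arc v i j = Laplacian e arc (punchIn v i) (punchIn v j)

SandpileGroup : ∀ {m} (e : ℕ) → (Fin (suc m) → Fin e → Fin (suc m)) →
                Fin (suc m) → SubQuot m
SandpileGroup {m} e arc v = record
  { Sub = Torsion (ReducedLaplacian e arc v) ; nrel = m
  ; rel = ReducedLaplacian e arc v }

-- the graph attached to d : DB(n,d) if d > 0, Ktz(n,|d|) if d < 0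
-- (d = 0 is excluded by |d| ≥ 2 in the theorem)
outdeg : ℤ → ℕ
outdeg (+ e)     = e
outdeg -[1+ k ]  = suc k

Graph : (n : ℕ) .{{_ : NonZero n}} (d : ℤ) → Fin n → Fin (outdeg d) → Fin n
Graph n (+ e)    = DB n e
Graph n -[1+ k ] = Ktz n (suc k)

-- ℤ[x,x⁻¹]/(xⁿ−1) ≅ ℤ^n via coefficients; x^a ↦ unit vector at a mod n

mono : (n : ℕ) .{{_ : NonZero n}} → ℤ → Vecℤ n
mono n a = δ (idx n a)

f : (n : ℕ) .{{_ : NonZero n}} → ℤ → ℤ → Vecℤ n
f n (+ e)    v w = + e * mono n v w - ∑ {e} (λ i → mono n (+ e * v + + toℕ i) w)
f n -[1+ k ] v w = -[1+ k ] * mono n v w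
                   + ∑ {suc k} (λ i → mono n (-[1+ k ] * (v + 1ℤ) + + toℕ i) w)

-- 𝒵_n : ℤ-span of x^v − 1, 1 ≤ v ≤ n−1  (generator j ↦ v = j+1)
𝒵gen : (n : ℕ) .{{_ : NonZero n}} → Fin (ℕ.pred n) → Vecℤ n
𝒵gen n j = mono n (+ suc (toℕ j)) ⊖ mono n 0ℤ

PolyQuot : (n : ℕ) .{{_ : NonZero n}} → ℤ → SubQuot n
PolyQuot n d = record
  { Sub = InSpan (𝒵gen n) ; nrel = ℕ.pred n
  ; rel = λ j → f n d (+ suc (toℕ j)) }

module Submission where

-- Let e = |d| and Δ = e·I − A the Laplacian.  Up to the sign of d, f_v is the
-- row Δ_v; both graphs are Eulerian, so the columns of Δ sum to 0 and
-- Δ_0 = −∑_{v≥1} Δ_v, whence ⟨f_v⟩ = ℤⁿΔ.  The rows of Δ sum to 0, so torsion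
-- elements lie in the sum-zero lattice 𝒵_n.  Conversely every z ∈ 𝒵_n is
-- torsion: modulo ℤⁿΔ, e^k z ≡ z A^k; the walks of length k out of a vertex
-- end in an interval of e^k consecutive residues whose start is affine in the
-- vertex, so z A^k depends only on three residues mod n; by pigeonhole these
-- recur at some k < k′, and then (e^k′ − e^k) z ∈ ℤⁿΔ.  Hence the critical
-- group is 𝒵_n/⟨f_v⟩ via the identity map, and the sandpile group at v is
-- too, via y ↦ ∑ⱼ yⱼ (x^{u_j} − x^v) where u_j runs over the vertices ≠ v.

open import Defs
open import Data.Nat.Base as ℕ using (ℕ; zero; suc; NonZero; _≤_)
import Data.Nat.Properties as ℕ
import Data.Nat.Divisibility as ℕ
open import Data.Nat.DivMod using (m<n⇒m%n≡m)
open import Data.Integer.Base using (ℤ; +_; -[1+_]; _+_; _*_; -_; _-_; 0ℤ; 1ℤ; ∣_∣; _%ℕ_; _/ℕ_; _^_)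
  renaming (_⊖_ to _⊖ℕ_)
import Data.Integer.Properties as ℤ
open import Data.Integer.DivMod using (a≡a%ℕn+[a/ℕn]*n; n%ℕd<d)
open import Data.Integer.Divisibility.Signed using (_∣_; divides; ∣⇒∣ᵤ; ∣m∣n⇒∣m+n; ∣m⇒∣-m; ∣m⇒∣m*n; ∣n⇒∣m*n)
open import Data.Integer.Tactic.RingSolver using (solve-∀)
open import Algebra.Properties.Semiring.Sum ℤ.+-*-semiring using (sum; sum-cong-≗; ∑-distrib-+; ∑-comm; sum-remove; *-distribˡ-sum)
open import Algebra.Properties.AbelianGroup ℤ.+-0-abelianGroup using (∙-cancelˡ)
open import Data.Fin.Base using (Fin; zero; suc; toℕ; punchIn; punchOut; combine)
import Data.Fin.Properties as Fin
open import Data.Product.Base using (_,_; _×_; ∃₂; proj₁; proj₂)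
open import Relation.Nullary using (¬_; yes; no; contradiction)
open import Relation.Binary.PropositionalEquality

-- The sum ∑ of Defs is the library's finite sum over the semiring ℤ;
-- this lets us borrow the library's algebra of finite sums.
∑≡sum : ∀ {k} (f : Fin k → ℤ) → ∑ f ≡ sum f
∑≡sum {zero}  f = refl
∑≡sum {suc k} f = cong (_+_ (f zero)) (∑≡sum (λ i → f (suc i)))

∑-cong : ∀ {k} {f g : Fin k → ℤ} → (∀ i → f i ≡ g i) → ∑ f ≡ ∑ g
∑-cong {f = f} {g} f≗g = trans (∑≡sum f) (trans (sum-cong-≗ f≗g) (sym (∑≡sum g)))

∑-+ : ∀ {k} (f g : Fin k → ℤ) → ∑ (λ i → f i + g i) ≡ ∑ f + ∑ g
∑-+ f g = begin
  ∑ (λ i → f i + g i)   ≡⟨ ∑≡sum (λ i → f i + g i) ⟩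
  sum (λ i → f i + g i) ≡⟨ ∑-distrib-+ f g ⟩
  sum f + sum g         ≡⟨ sym (cong₂ _+_ (∑≡sum f) (∑≡sum g)) ⟩
  ∑ f + ∑ g             ∎
  where open ≡-Reasoning

∑-*ˡ : ∀ {k} (c : ℤ) (f : Fin k → ℤ) → ∑ (λ i → c * f i) ≡ c * ∑ f
∑-*ˡ c f = begin
  ∑ (λ i → c * f i)   ≡⟨ ∑≡sum (λ i → c * f i) ⟩
  sum (λ i → c * f i) ≡⟨ sym (*-distribˡ-sum c f) ⟩
  c * sum f           ≡⟨ sym (cong (c *_) (∑≡sum f)) ⟩
  c * ∑ f             ∎
  where open ≡-Reasoning

∑-*ʳ : ∀ {k} (c : ℤ) (f : Fin k → ℤ) → ∑ (λ i → f i * c) ≡ ∑ f * c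
∑-*ʳ c f = trans (∑-cong (λ i → ℤ.*-comm (f i) c)) (trans (∑-*ˡ c f) (ℤ.*-comm c (∑ f)))

∑-swap : ∀ {k l} (f : Fin k → Fin l → ℤ) → ∑ (λ i → ∑ (f i)) ≡ ∑ (λ j → ∑ (λ i → f i j))
∑-swap f = begin
  ∑ (λ i → ∑ (f i))                  ≡⟨ trans (∑-cong (λ i → ∑≡sum (f i))) (∑≡sum (λ i → sum (f i))) ⟩
  sum (λ i → sum (f i))              ≡⟨ ∑-comm f ⟩
  sum (λ j → sum (λ i → f i j))      ≡⟨ sym (trans (∑-cong (λ j → ∑≡sum (λ i → f i j))) (∑≡sum (λ j → sum (λ i → f i j)))) ⟩
  ∑ (λ j → ∑ (λ i → f i j))          ∎
  where open ≡-Reasoning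

∑-punchIn : ∀ {k} (v : Fin (suc k)) (f : Fin (suc k) → ℤ) → ∑ f ≡ f v + ∑ (λ j → f (punchIn v j))
∑-punchIn v f = trans (∑≡sum f) (trans (sum-remove {i = v} f) (cong (_+_ (f v)) (sym (∑≡sum (λ j → f (punchIn v j))))))

∑-- : ∀ {k} (f g : Fin k → ℤ) → ∑ (λ i → f i - g i) ≡ ∑ f - ∑ g
∑-- f g = begin
  ∑ (λ i → f i - g i)          ≡⟨ ∑-+ f (λ i → - g i) ⟩
  ∑ f + ∑ (λ i → - g i)        ≡⟨ cong (_+_ (∑ f)) (∑-cong (λ i → sym (ℤ.-1*i≡-i (g i)))) ⟩
  ∑ f + ∑ (λ i → - 1ℤ * g i)   ≡⟨ cong (_+_ (∑ f)) (trans (∑-*ˡ (- 1ℤ) g) (ℤ.-1*i≡-i (∑ g))) ⟩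
  ∑ f - ∑ g                    ∎
  where open ≡-Reasoning

∑-const : ∀ k (c : ℤ) → ∑ {k} (λ _ → c) ≡ + k * c
∑-const zero    c = sym (ℤ.*-zeroˡ c)
∑-const (suc k) c = begin
  c + ∑ {k} (λ _ → c)  ≡⟨ cong (_+_ c) (∑-const k c) ⟩
  c + + k * c          ≡⟨ cong (_+ + k * c) (sym (ℤ.*-identityˡ c)) ⟩
  1ℤ * c + + k * c     ≡⟨ sym (ℤ.*-distribʳ-+ c 1ℤ (+ k)) ⟩
  + suc k * c          ∎
  where open ≡-Reasoning

∑-zero : ∀ {k} {f : Fin k → ℤ} → (∀ i → f i ≡ 0ℤ) → ∑ f ≡ 0ℤ
∑-zero {k} f≗0 = trans (∑-cong f≗0) (trans (∑-const k 0ℤ) (ℤ.*-zeroʳ (+ k)))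

δ-diag : ∀ {k} (v : Fin k) → δ v v ≡ 1ℤ
δ-diag zero    = refl
δ-diag (suc v) = δ-diag v

δ-off : ∀ {k} {v w : Fin k} → ¬ v ≡ w → δ v w ≡ 0ℤ
δ-off {v = v} {w} v≢w with v Fin.≟ w
... | yes v≡w = contradiction v≡w v≢w
... | no  _   = refl

δ-sym : ∀ {k} (v w : Fin k) → δ v w ≡ δ w v
δ-sym v w with v Fin.≟ w | w Fin.≟ v
... | yes _   | yes _   = refl
... | no  _   | no  _   = refl
... | yes v≡w | no  w≢v = contradiction (sym v≡w) w≢v
... | no  v≢w | yes w≡v = contradiction (sym w≡v) v≢w

∑-δˡ : ∀ {k} (u : Fin k) (g : Fin k → ℤ) → ∑ (λ w → δ u w * g w) ≡ g u
∑-δˡ {suc k} u g = begin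
  ∑ (λ w → δ u w * g w)                                   ≡⟨ ∑-punchIn u (λ w → δ u w * g w) ⟩
  δ u u * g u + ∑ (λ j → δ u (punchIn u j) * g (punchIn u j)) ≡⟨ cong₂ _+_ (cong (_* g u) (δ-diag u)) (∑-zero off) ⟩
  1ℤ * g u + 0ℤ                                           ≡⟨ trans (ℤ.+-identityʳ (1ℤ * g u)) (ℤ.*-identityˡ (g u)) ⟩
  g u                                                     ∎
  where
  open ≡-Reasoning
  off : ∀ j → δ u (punchIn u j) * g (punchIn u j) ≡ 0ℤ
  off j = trans (cong (_* g (punchIn u j)) (δ-off (λ u≡ → Fin.punchInᵢ≢i u j (sym u≡)))) (ℤ.*-zeroˡ (g (punchIn u j)))

∑-δʳ : ∀ {k} (u : Fin k) (g : Fin k → ℤ) → ∑ (λ w → g w * δ w u) ≡ g u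
∑-δʳ u g = trans (∑-cong (λ w → trans (ℤ.*-comm (g w) (δ w u)) (cong (_* g w) (δ-sym w u)))) (∑-δˡ u g)

∑-δ : ∀ {k} (u : Fin k) → ∑ (δ u) ≡ 1ℤ
∑-δ u = trans (∑-cong (λ w → sym (ℤ.*-identityʳ (δ u w)))) (∑-δˡ u (λ _ → 1ℤ))

∑-δ′ : ∀ {k} (u : Fin k) → ∑ (λ w → δ w u) ≡ 1ℤ
∑-δ′ u = trans (∑-cong (λ w → δ-sym w u)) (∑-δ u)

-- The ℤ-span of a finite family is a subgroup; the family is explicit
-- because InSpan unfolds to a Σ-type from which it cannot be inferred.
module _ {r k : ℕ} (g : Fin r → Vecℤ k) where

  span-resp : ∀ {x y : Vecℤ k} → (∀ j → x j ≡ y j) → InSpan g x → InSpan g y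
  span-resp x≗y (c , x≡) = c , λ j → trans (sym (x≗y j)) (x≡ j)

  span-zero : ∀ {x : Vecℤ k} → (∀ j → x j ≡ 0ℤ) → InSpan g x
  span-zero x≗0 = (λ _ → 0ℤ) , λ j → trans (x≗0 j) (sym (∑-zero (λ i → ℤ.*-zeroˡ (g i j))))

  span-+ : ∀ {x y : Vecℤ k} → InSpan g x → InSpan g y → InSpan g (x ⊕ y)
  span-+ (c , x≡) (c′ , y≡) = (λ i → c i + c′ i) , λ j → begin
    _                                               ≡⟨ cong₂ _+_ (x≡ j) (y≡ j) ⟩
    ∑ (λ i → c i * g i j) + ∑ (λ i → c′ i * g i j)  ≡⟨ sym (∑-+ (λ i → c i * g i j) (λ i → c′ i * g i j)) ⟩
    ∑ (λ i → c i * g i j + c′ i * g i j)            ≡⟨ ∑-cong (λ i → sym (ℤ.*-distribʳ-+ (g i j) (c i) (c′ i))) ⟩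
    ∑ (λ i → (c i + c′ i) * g i j)                  ∎
    where open ≡-Reasoning

  span-• : ∀ (a : ℤ) {x : Vecℤ k} → InSpan g x → InSpan g (a • x)
  span-• a (c , x≡) = (λ i → a * c i) , λ j → begin
    a * _                         ≡⟨ cong (_*_ a) (x≡ j) ⟩
    a * ∑ (λ i → c i * g i j)     ≡⟨ sym (∑-*ˡ a (λ i → c i * g i j)) ⟩
    ∑ (λ i → a * (c i * g i j))   ≡⟨ ∑-cong (λ i → sym (ℤ.*-assoc a (c i) (g i j))) ⟩
    ∑ (λ i → a * c i * g i j)     ∎
    where open ≡-Reasoning

  span-neg : ∀ {x : Vecℤ k} → InSpan g x → InSpan g (λ j → - x j)
  span-neg s = span-resp (λ j → ℤ.-1*i≡-i _) (span-• (- 1ℤ) s)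

  span-⊖ : ∀ {x y : Vecℤ k} → InSpan g x → InSpan g y → InSpan g (x ⊖ y)
  span-⊖ s t = span-+ s (span-neg t)

  span-gen : ∀ i → InSpan g (g i)
  span-gen i = δ i , λ j → sym (∑-δˡ i (λ l → g l j))

  span-∑ : ∀ {s} (F : Fin s → Vecℤ k) → (∀ l → InSpan g (F l)) → InSpan g (λ j → ∑ (λ l → F l j))
  span-∑ {zero}  F F∈ = span-zero (λ _ → refl)
  span-∑ {suc s} F F∈ = span-+ (F∈ zero) (span-∑ (λ l → F (suc l)) (λ l → F∈ (suc l)))

  span-⊖-self : ∀ (x : Vecℤ k) → InSpan g (x ⊖ x)
  span-⊖-self x = span-zero (λ j → ℤ.+-inverseʳ (x j))

  span-sum-zero : (∀ i → ∑ (g i) ≡ 0ℤ) → ∀ {x} → InSpan g x → ∑ x ≡ 0ℤ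
  span-sum-zero g-sum {x} (c , x≡) = begin
    ∑ x                               ≡⟨ ∑-cong x≡ ⟩
    ∑ (λ j → ∑ (λ i → c i * g i j))   ≡⟨ ∑-swap (λ j i → c i * g i j) ⟩
    ∑ (λ i → ∑ (λ j → c i * g i j))   ≡⟨ ∑-zero (λ i → trans (∑-*ˡ (c i) (g i)) (trans (cong (_*_ (c i)) (g-sum i)) (ℤ.*-zeroʳ (c i)))) ⟩
    0ℤ                                ∎
    where open ≡-Reasoning

span-mono : ∀ {r r′ k} (g : Fin r → Vecℤ k) (h : Fin r′ → Vecℤ k) →
            (∀ i → InSpan h (g i)) → ∀ {x} → InSpan g x → InSpan h x
span-mono g h g⊆h (c , x≡) =
  span-resp h (λ j → sym (x≡ j)) (span-∑ h (λ i → c i • g i) (λ i → span-• h (c i) (g⊆h i)))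

lincomb : ∀ {r k} → (Fin r → Vecℤ k) → Vecℤ r → Vecℤ k
lincomb G c w = ∑ (λ i → c i * G i w)

module _ {r k : ℕ} (G : Fin r → Vecℤ k) where

  lincomb-+ : ∀ c c′ w → lincomb G (c ⊕ c′) w ≡ lincomb G c w + lincomb G c′ w
  lincomb-+ c c′ w = trans (∑-cong (λ i → ℤ.*-distribʳ-+ (G i w) (c i) (c′ i)))
                           (∑-+ (λ i → c i * G i w) (λ i → c′ i * G i w))

  lincomb-⊖ : ∀ c c′ w → lincomb G (c ⊖ c′) w ≡ lincomb G c w - lincomb G c′ w
  lincomb-⊖ c c′ w = trans (∑-cong (λ i → distrib (c i) (c′ i) (G i w)))
                           (∑-- (λ i → c i * G i w) (λ i → c′ i * G i w))
    where distrib : ∀ a b g → (a - b) * g ≡ a * g - b * g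
          distrib = solve-∀

  lincomb-span : ∀ {s t} {g : Fin s → Vecℤ r} {h : Fin t → Vecℤ k} →
                 (∀ l → InSpan h (lincomb G (g l))) → ∀ {c} → InSpan g c → InSpan h (lincomb G c)
  lincomb-span {g = g} {h} Gg∈ {c} (a , c≡) = span-resp h linear (span-∑ h (λ l → a l • lincomb G (g l)) (λ l → span-• h (a l) (Gg∈ l)))
    where
    open ≡-Reasoning
    linear : ∀ w → ∑ (λ l → a l * lincomb G (g l) w) ≡ lincomb G c w
    linear w = begin
      ∑ (λ l → a l * ∑ (λ i → g l i * G i w))      ≡⟨ ∑-cong (λ l → sym (∑-*ˡ (a l) (λ i → g l i * G i w))) ⟩
      ∑ (λ l → ∑ (λ i → a l * (g l i * G i w)))    ≡⟨ ∑-swap (λ l i → a l * (g l i * G i w)) ⟩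
      ∑ (λ i → ∑ (λ l → a l * (g l i * G i w)))    ≡⟨ ∑-cong (λ i → ∑-cong (λ l → sym (ℤ.*-assoc (a l) (g l i) (G i w)))) ⟩
      ∑ (λ i → ∑ (λ l → a l * g l i * G i w))      ≡⟨ ∑-cong (λ i → trans (∑-*ʳ (G i w) (λ l → a l * g l i)) (cong (_* G i w) (sym (c≡ i)))) ⟩
      ∑ (λ i → c i * G i w)                         ∎

span-restrict : ∀ {r m n} (π : Fin m → Fin n) (g : Fin r → Vecℤ n) {x} →
                InSpan g x → InSpan (λ i j → g i (π j)) (λ j → x (π j))
span-restrict π g (c , x≡) = c , λ j → x≡ (π j)

module Residues (n : ℕ) .{{_ : NonZero n}} where

  -- a ≡ₙ b iff n divides a - b.  (A record, so that a and b stay inferable.)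
  infix 4 _≡ₙ_
  record _≡ₙ_ (a b : ℤ) : Set where
    constructor mod
    field divisible : + n ∣ a - b

  ≡ₙ-reflexive : ∀ {a b} → a ≡ b → a ≡ₙ b
  ≡ₙ-reflexive {a} refl = mod (divides 0ℤ (ℤ.+-inverseʳ a))

  ≡ₙ-refl : ∀ {a} → a ≡ₙ a
  ≡ₙ-refl = ≡ₙ-reflexive refl

  ≡ₙ-sym : ∀ {a b} → a ≡ₙ b → b ≡ₙ a
  ≡ₙ-sym {a} {b} (mod n∣a-b) = mod (subst (+ n ∣_) (neg-diff a b) (∣m⇒∣-m n∣a-b))
    where neg-diff : ∀ a b → - (a - b) ≡ b - a
          neg-diff = solve-∀

  ≡ₙ-trans : ∀ {a b c} → a ≡ₙ b → b ≡ₙ c → a ≡ₙ c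
  ≡ₙ-trans {a} {b} {c} (mod p) (mod q) = mod (subst (+ n ∣_) (chain a b c) (∣m∣n⇒∣m+n p q))
    where chain : ∀ a b c → (a - b) + (b - c) ≡ a - c
          chain = solve-∀

  ≡ₙ-+ : ∀ {a a′ b b′} → a ≡ₙ a′ → b ≡ₙ b′ → a + b ≡ₙ a′ + b′
  ≡ₙ-+ {a} {a′} {b} {b′} (mod p) (mod q) = mod (subst (+ n ∣_) (split a a′ b b′) (∣m∣n⇒∣m+n p q))
    where split : ∀ a a′ b b′ → (a - a′) + (b - b′) ≡ (a + b) - (a′ + b′)
          split = solve-∀

  ≡ₙ-* : ∀ {a a′ b b′} → a ≡ₙ a′ → b ≡ₙ b′ → a * b ≡ₙ a′ * b′
  ≡ₙ-* {a} {a′} {b} {b′} (mod p) (mod q) =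
    mod (subst (+ n ∣_) (split a a′ b b′) (∣m∣n⇒∣m+n (∣m⇒∣m*n b p) (∣n⇒∣m*n a′ q)))
    where split : ∀ a a′ b b′ → (a - a′) * b + a′ * (b - b′) ≡ a * b - a′ * b′
          split = solve-∀

  +-multiple : ∀ a t → a + t * + n ≡ₙ a
  +-multiple a t = mod (divides t (cancel a t (+ n)))
    where cancel : ∀ a t n → (a + t * n) - a ≡ t * n
          cancel = solve-∀

  ≡ₙ-%ℕ : ∀ a → + (a %ℕ n) ≡ₙ a
  ≡ₙ-%ℕ a = ≡ₙ-sym (subst (_≡ₙ + (a %ℕ n)) (sym (a≡a%ℕn+[a/ℕn]*n a n)) (+-multiple (+ (a %ℕ n)) (a /ℕ n)))

  residue-unique : ∀ {r s} → r ℕ.< n → s ℕ.< n → + r ≡ₙ + s → r ≡ s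
  residue-unique {r} {s} r<n s<n (mod n∣r-s) = ℤ.+-injective (ℤ.i-j≡0⇒i≡j (+ r) (+ s) r-s≡0)
    where
    n∣∣r⊖s∣ : n ℕ.∣ ∣ r ⊖ℕ s ∣
    n∣∣r⊖s∣ = subst (λ i → n ℕ.∣ ∣ i ∣) (ℤ.m-n≡m⊖n r s) (∣⇒∣ᵤ n∣r-s)
    ∣r⊖s∣<n : ∣ r ⊖ℕ s ∣ ℕ.< n
    ∣r⊖s∣<n = ℕ.≤-<-trans (ℤ.∣m⊝n∣≤m⊔n r s) (ℕ.⊔-pres-<m r<n s<n)
    r-s≡0 : + r - + s ≡ 0ℤ
    r-s≡0 = ℤ.∣i∣≡0⇒i≡0 (trans (cong ∣_∣ (ℤ.m-n≡m⊖n r s))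
              (trans (sym (m<n⇒m%n≡m ∣r⊖s∣<n)) (ℕ.n∣m⇒m%n≡0 _ n n∣∣r⊖s∣)))

  idx-cong : ∀ {a b} → a ≡ₙ b → idx n a ≡ idx n b
  idx-cong {a} {b} a≡b = Fin.fromℕ<-cong _ _ same-residue (n%ℕd<d a n) (n%ℕd<d b n)
    where same-residue : a %ℕ n ≡ b %ℕ n
          same-residue = residue-unique (n%ℕd<d a n) (n%ℕd<d b n)
                           (≡ₙ-trans (≡ₙ-%ℕ a) (≡ₙ-trans a≡b (≡ₙ-sym (≡ₙ-%ℕ b))))

  vtx-idx : ∀ a → vtx (idx n a) ≡ₙ a
  vtx-idx a = subst (_≡ₙ a) (cong +_ (sym (Fin.toℕ-fromℕ< (n%ℕd<d a n)))) (≡ₙ-%ℕ a)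

  idx-injective : ∀ {a b} → idx n a ≡ idx n b → a ≡ₙ b
  idx-injective {a} {b} eq =
    ≡ₙ-trans (≡ₙ-sym (vtx-idx a)) (≡ₙ-trans (≡ₙ-reflexive (cong vtx eq)) (vtx-idx b))

  idx-vtx : ∀ (v : Fin n) → idx n (vtx v) ≡ v
  idx-vtx v = Fin.toℕ-injective (trans (Fin.toℕ-fromℕ< (n%ℕd<d (vtx v) n)) (m<n⇒m%n≡m (Fin.toℕ<n v)))

∑ℕ : ℕ → (ℕ → ℤ) → ℤ
∑ℕ zero    F = 0ℤ
∑ℕ (suc L) F = F 0 + ∑ℕ L (λ j → F (suc j))

∑ℕ≡∑ : ∀ L (F : ℕ → ℤ) → ∑ {L} (λ i → F (toℕ i)) ≡ ∑ℕ L F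
∑ℕ≡∑ zero    F = refl
∑ℕ≡∑ (suc L) F = cong (_+_ (F 0)) (∑ℕ≡∑ L (λ j → F (suc j)))

∑ℕ-cong : ∀ L {F G : ℕ → ℤ} → (∀ j → F j ≡ G j) → ∑ℕ L F ≡ ∑ℕ L G
∑ℕ-cong zero    F≗G = refl
∑ℕ-cong (suc L) F≗G = cong₂ _+_ (F≗G 0) (∑ℕ-cong L (λ j → F≗G (suc j)))

∑ℕ-++ : ∀ L₁ L₂ (F : ℕ → ℤ) → ∑ℕ (L₁ ℕ.+ L₂) F ≡ ∑ℕ L₁ F + ∑ℕ L₂ (λ j → F (L₁ ℕ.+ j))
∑ℕ-++ zero     L₂ F = sym (ℤ.+-identityˡ _)
∑ℕ-++ (suc L₁) L₂ F = trans (cong (_+_ (F 0)) (∑ℕ-++ L₁ L₂ (λ j → F (suc j))))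
                            (sym (ℤ.+-assoc (F 0) (∑ℕ L₁ (λ j → F (suc j))) _))

∑ℕ-*ʳ : ∀ L (c : ℤ) (F : ℕ → ℤ) → ∑ℕ L (λ j → F j * c) ≡ ∑ℕ L F * c
∑ℕ-*ʳ L c F = begin
  ∑ℕ L (λ j → F j * c)            ≡⟨ sym (∑ℕ≡∑ L (λ j → F j * c)) ⟩
  ∑ {L} (λ i → F (toℕ i) * c)     ≡⟨ ∑-*ʳ {L} c (λ i → F (toℕ i)) ⟩
  ∑ {L} (λ i → F (toℕ i)) * c     ≡⟨ cong (_* c) (∑ℕ≡∑ L F) ⟩
  ∑ℕ L F * c                      ∎
  where open ≡-Reasoning

∑-∑ℕ : ∀ {k} L (F : Fin k → ℕ → ℤ) → ∑ (λ i → ∑ℕ L (F i)) ≡ ∑ℕ L (λ j → ∑ (λ i → F i j))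
∑-∑ℕ L F = begin
  ∑ (λ i → ∑ℕ L (F i))                    ≡⟨ ∑-cong (λ i → sym (∑ℕ≡∑ L (F i))) ⟩
  ∑ (λ i → ∑ {L} (λ j → F i (toℕ j)))     ≡⟨ ∑-swap {l = L} (λ i j → F i (toℕ j)) ⟩
  ∑ {L} (λ j → ∑ (λ i → F i (toℕ j)))     ≡⟨ ∑ℕ≡∑ L (λ j → ∑ (λ i → F i j)) ⟩
  ∑ℕ L (λ j → ∑ (λ i → F i j))            ∎
  where open ≡-Reasoning

-- The interval vector  interval a L  is the coefficient vector of
-- x^a + x^(a+1) + … + x^(a+L-1)  in ℤ[x]/(xⁿ − 1) ≅ ℤⁿ.
module Intervals (n : ℕ) .{{_ : NonZero n}} where
  open Residues n

  interval : ℤ → ℕ → Vecℤ n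
  interval a L w = ∑ℕ L (λ j → δ (idx n (a + + j)) w)

  interval-cong : ∀ {a a′} L w → a ≡ₙ a′ → interval a L w ≡ interval a′ L w
  interval-cong L w a≡a′ = ∑ℕ-cong L (λ j → cong (λ u → δ u w) (idx-cong (≡ₙ-+ a≡a′ ≡ₙ-refl)))

  interval-++ : ∀ a L₁ L₂ w → interval a (L₁ ℕ.+ L₂) w ≡ interval a L₁ w + interval (a + + L₁) L₂ w
  interval-++ a L₁ L₂ w = trans (∑ℕ-++ L₁ L₂ _) (cong (_+_ (interval a L₁ w)) (∑ℕ-cong L₂ shift))
    where shift : ∀ j → δ (idx n (a + + (L₁ ℕ.+ j))) w ≡ δ (idx n (a + + L₁ + + j)) w
          shift j = cong (λ u → δ (idx n u) w) (trans (cong (_+_ a) (ℤ.pos-+ L₁ j)) (sym (ℤ.+-assoc a (+ L₁) (+ j))))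

  interval-single : ∀ a w → interval a 1 w ≡ δ (idx n a) w
  interval-single a w = trans (ℤ.+-identityʳ _) (cong (λ u → δ u w) (idx-cong (≡ₙ-reflexive (ℤ.+-identityʳ a))))

  -- n consecutive integers meet every residue class once: shifting a full
  -- interval by one replaces its first element a by a + n ≡ a.
  full-shift : ∀ a w → interval (a + 1ℤ) n w ≡ interval a n w
  full-shift a w = ∙-cancelˡ (interval a 1 w) _ _ (begin
    interval a 1 w + interval (a + 1ℤ) n w   ≡⟨ sym (interval-++ a 1 n w) ⟩
    interval a (1 ℕ.+ n) w                   ≡⟨ cong (λ L → interval a L w) (ℕ.+-comm 1 n) ⟩
    interval a (n ℕ.+ 1) w                   ≡⟨ interval-++ a n 1 w ⟩
    interval a n w + interval (a + + n) 1 w  ≡⟨ cong (_+_ (interval a n w)) (interval-cong 1 w a+n≡a) ⟩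
    interval a n w + interval a 1 w          ≡⟨ ℤ.+-comm (interval a n w) (interval a 1 w) ⟩
    interval a 1 w + interval a n w          ∎)
    where
    open ≡-Reasoning
    a+n≡a : a + + n ≡ₙ a
    a+n≡a = subst (λ t → a + t ≡ₙ a) (ℤ.*-identityˡ (+ n)) (+-multiple a 1ℤ)

  full-start : ∀ a w → interval a n w ≡ interval 0ℤ n w
  full-start (+ zero)    w = refl
  full-start (+ suc k)   w = trans (cong (λ u → interval u n w) (ℤ.+-comm 1ℤ (+ k)))
                                   (trans (full-shift (+ k) w) (full-start (+ k) w))
  full-start -[1+ zero ]  w = sym (full-shift -[1+ zero ] w)
  full-start -[1+ suc k ] w = trans (sym (full-shift -[1+ suc k ] w)) (full-start -[1+ k ] w)

  interval-full : ∀ a w → interval a n w ≡ 1ℤ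
  interval-full a w = begin
    interval a n w                           ≡⟨ full-start a w ⟩
    ∑ℕ n (λ j → δ (idx n (+ j)) w)           ≡⟨ sym (∑ℕ≡∑ n (λ j → δ (idx n (+ j)) w)) ⟩
    ∑ {n} (λ v → δ (idx n (vtx v)) w)        ≡⟨ ∑-cong (λ v → cong (λ u → δ u w) (idx-vtx v)) ⟩
    ∑ (λ v → δ v w)                          ≡⟨ ∑-δ′ w ⟩
    1ℤ                                       ∎
    where open ≡-Reasoning

  interval-multiple : ∀ a q w → interval a (q ℕ.* n) w ≡ + q
  interval-multiple a zero    w = refl
  interval-multiple a (suc q) w = trans (interval-++ a n (q ℕ.* n) w)
                                        (cong₂ _+_ (interval-full a w) (interval-multiple (a + + n) q w))

  length-difference : ∀ L L′ t → + L′ - + L ≡ + t * + n → L′ ≡ L ℕ.+ t ℕ.* n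
  length-difference L L′ t eq = ℤ.+-injective (begin
    + L′                  ≡⟨ move (+ L′) (+ L) ⟩
    + L + (+ L′ - + L)    ≡⟨ cong (_+_ (+ L)) (trans eq (sym (ℤ.pos-* t n))) ⟩
    + L + + (t ℕ.* n)     ≡⟨ sym (ℤ.pos-+ L (t ℕ.* n)) ⟩
    + (L ℕ.+ t ℕ.* n)     ∎)
    where
    open ≡-Reasoning
    move : ∀ x y → x ≡ y + (x - y)
    move = solve-∀

  interval-+multiple : ∀ a L t w → interval a (L ℕ.+ t ℕ.* n) w ≡ interval a L w + + t
  interval-+multiple a L t w = trans (interval-++ a L (t ℕ.* n) w)
                                     (cong (_+_ (interval a L w)) (interval-multiple (a + + L) t w))

  interval-length : ∀ a L L′ T w → + L′ - + L ≡ T * + n → interval a L′ w ≡ interval a L w + T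
  interval-length a L L′ (+ t) w eq = begin
    interval a L′ w               ≡⟨ cong (λ l → interval a l w) (length-difference L L′ t eq) ⟩
    interval a (L ℕ.+ t ℕ.* n) w  ≡⟨ interval-+multiple a L t w ⟩
    interval a L w + + t          ∎
    where open ≡-Reasoning
  interval-length a L L′ -[1+ t ] w eq = begin
    interval a L′ w                                 ≡⟨ cancel (interval a L′ w) (+ suc t) ⟩
    interval a L′ w + + suc t + -[1+ t ]            ≡⟨ cong (_+ -[1+ t ]) (sym (interval-+multiple a L′ (suc t) w)) ⟩
    interval a (L′ ℕ.+ suc t ℕ.* n) w + -[1+ t ]    ≡⟨ cong (λ l → interval a l w + -[1+ t ]) (sym L≡) ⟩
    interval a L w + -[1+ t ]                       ∎
    where
    open ≡-Reasoning
    cancel : ∀ x s → x ≡ x + s + - s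
    cancel = solve-∀
    flip : ∀ x y → - (x - y) ≡ y - x
    flip = solve-∀
    L≡ : L ≡ L′ ℕ.+ suc t ℕ.* n
    L≡ = length-difference L′ L (suc t)
           (trans (sym (flip (+ L′) (+ L))) (trans (cong -_ eq) (ℤ.neg-distribˡ-* -[1+ t ] (+ n))))

  blocks-ascending : ∀ s e L w → ∑ℕ L (λ j → interval (s + + e * + j) e w) ≡ interval s (L ℕ.* e) w
  blocks-ascending s e zero    w = refl
  blocks-ascending s e (suc L) w = begin
    interval (s + + e * 0ℤ) e w + ∑ℕ L (λ j → interval (s + + e * + suc j) e w)
      ≡⟨ cong₂ _+_ (interval-cong e w (≡ₙ-reflexive (drop s (+ e))))
                   (∑ℕ-cong L (λ j → interval-cong e w (≡ₙ-reflexive (shift s (+ e) (+ j))))) ⟩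
    interval s e w + ∑ℕ L (λ j → interval (s + + e + + e * + j) e w)
      ≡⟨ cong (_+_ (interval s e w)) (blocks-ascending (s + + e) e L w) ⟩
    interval s e w + interval (s + + e) (L ℕ.* e) w
      ≡⟨ sym (interval-++ s e (L ℕ.* e) w) ⟩
    interval s (e ℕ.+ L ℕ.* e) w ∎
    where
    open ≡-Reasoning
    drop : ∀ s e → s + e * 0ℤ ≡ s
    drop = solve-∀
    shift : ∀ s e j → s + e * (1ℤ + j) ≡ s + e + e * j
    shift = solve-∀

  blocks-descending : ∀ s e L w → ∑ℕ L (λ j → interval (s - + e * + j) e w) ≡ interval (s + + e - + (L ℕ.* e)) (L ℕ.* e) w
  blocks-descending s e zero    w = refl
  blocks-descending s e (suc L) w = begin
    interval (s - + e * 0ℤ) e w + ∑ℕ L (λ j → interval (s - + e * + suc j) e w)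
      ≡⟨ cong₂ _+_ (interval-cong e w (≡ₙ-reflexive (drop s (+ e))))
                   (∑ℕ-cong L (λ j → interval-cong e w (≡ₙ-reflexive (shift s (+ e) (+ j))))) ⟩
    interval s e w + ∑ℕ L (λ j → interval (s - + e - + e * + j) e w)
      ≡⟨ cong (_+_ (interval s e w)) (blocks-descending (s - + e) e L w) ⟩
    interval s e w + interval (s - + e + + e - + Le) Le w
      ≡⟨ ℤ.+-comm (interval s e w) _ ⟩
    interval (s - + e + + e - + Le) Le w + interval s e w
      ≡⟨ cong₂ _+_ (interval-cong Le w (≡ₙ-reflexive (start≡ s (+ e) (+ Le))))
                   (interval-cong e w (≡ₙ-reflexive (end≡ s (+ e) (+ Le)))) ⟩
    interval t Le w + interval (t + + Le) e w
      ≡⟨ sym (interval-++ t Le e w) ⟩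
    interval t (Le ℕ.+ e) w
      ≡⟨ cong (λ l → interval (s + + e - + l) l w) (ℕ.+-comm Le e) ⟩
    interval (s + + e - + (e ℕ.+ Le)) (e ℕ.+ Le) w ∎
    where
    open ≡-Reasoning
    Le = L ℕ.* e
    t = s + + e - + (Le ℕ.+ e)
    drop : ∀ s e → s - e * 0ℤ ≡ s
    drop = solve-∀
    shift : ∀ s e j → s - e * (1ℤ + j) ≡ s - e - e * j
    shift = solve-∀
    start≡ : ∀ s e l → s - e + e - l ≡ s + e - (l + e)
    start≡ = solve-∀
    end≡ : ∀ s e l → s ≡ s + e - (l + e) + l
    end≡ = solve-∀

module OutRegular {n : ℕ} (e : ℕ) (arc : Fin n → Fin e → Fin n) where

  Δ : Fin n → Vecℤ n
  Δ = Laplacian e arc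

  A : Fin n → Fin n → ℤ
  A u w = ∑ (λ i → δ (arc u i) w)

  Δ-row-sum : ∀ v → ∑ (Δ v) ≡ 0ℤ
  Δ-row-sum v = begin
    ∑ (λ w → + e * δ v w - A v w)       ≡⟨ ∑-- (λ w → + e * δ v w) (A v) ⟩
    ∑ (λ w → + e * δ v w) - ∑ (A v)     ≡⟨ cong₂ _-_ (trans (∑-*ˡ (+ e) (δ v)) (cong (_*_ (+ e)) (∑-δ v))) out-degree ⟩
    + e * 1ℤ - + e * 1ℤ                 ≡⟨ ℤ.+-inverseʳ (+ e * 1ℤ) ⟩
    0ℤ                                  ∎
    where
    open ≡-Reasoning
    out-degree : ∑ (A v) ≡ + e * 1ℤ
    out-degree = trans (∑-swap (λ w i → δ (arc v i) w)) (trans (∑-cong (λ i → ∑-δ (arc v i))) (∑-const e 1ℤ))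

  torsion⇒sum-zero : ∀ {x} → Torsion Δ x → ∑ x ≡ 0ℤ
  torsion⇒sum-zero {x} (N , N≢0 , N•x∈) = ℤ.*-cancelˡ-≡ (+ N) (∑ x) 0ℤ {{N≢0}} (begin
    + N * ∑ x              ≡⟨ sym (∑-*ˡ (+ N) x) ⟩
    ∑ ((+ N) • x)          ≡⟨ span-sum-zero Δ Δ-row-sum N•x∈ ⟩
    0ℤ                     ≡⟨ sym (ℤ.*-zeroʳ (+ N)) ⟩
    + N * 0ℤ               ∎)
    where open ≡-Reasoning

  walks : ℕ → Fin n → Fin n → ℤ
  walks zero    v w = δ v w
  walks (suc k) v w = ∑ (λ u → walks k v u * A u w)

  _·A^_ : Vecℤ n → ℕ → Vecℤ n
  (x ·A^ k) w = ∑ (λ v → x v * walks k v w)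

  ·A^-suc : ∀ x k w → (x ·A^ suc k) w ≡ ∑ (λ u → (x ·A^ k) u * A u w)
  ·A^-suc x k w = begin
    ∑ (λ v → x v * ∑ (λ u → walks k v u * A u w))        ≡⟨ ∑-cong (λ v → sym (∑-*ˡ (x v) (λ u → walks k v u * A u w))) ⟩
    ∑ (λ v → ∑ (λ u → x v * (walks k v u * A u w)))      ≡⟨ ∑-swap (λ v u → x v * (walks k v u * A u w)) ⟩
    ∑ (λ u → ∑ (λ v → x v * (walks k v u * A u w)))      ≡⟨ ∑-cong (λ u → ∑-cong (λ v → sym (ℤ.*-assoc (x v) (walks k v u) (A u w)))) ⟩
    ∑ (λ u → ∑ (λ v → x v * walks k v u * A u w))        ≡⟨ ∑-cong (λ u → ∑-*ʳ (A u w) (λ v → x v * walks k v u)) ⟩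
    ∑ (λ u → (x ·A^ k) u * A u w)                         ∎
    where open ≡-Reasoning

  -- Modulo the row lattice of Δ = e·I − A, multiplication by A is
  -- multiplication by e; hence e^k x ≡ x A^k.
  telescope : ∀ k x → InSpan Δ (((+ (e ℕ.^ k)) • x) ⊖ (x ·A^ k))
  telescope zero x = span-zero Δ (λ w → trans (cong (λ s → 1ℤ * x w - s) (∑-δʳ w x)) (cancel (x w)))
    where cancel : ∀ a → 1ℤ * a - a ≡ 0ℤ
          cancel = solve-∀
  telescope (suc k) x = span-resp Δ regroup (span-+ Δ (span-• Δ (+ e) (telescope k x)) one-step)
    where
    y = x ·A^ k
    one-step : InSpan Δ (((+ e) • y) ⊖ (λ w → ∑ (λ u → y u * A u w)))
    one-step = y , λ w → sym (begin
      ∑ (λ u → y u * (+ e * δ u w - A u w))               ≡⟨ ∑-cong (λ u → expand (y u) (+ e) (δ u w) (A u w)) ⟩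
      ∑ (λ u → + e * (y u * δ u w) - y u * A u w)         ≡⟨ ∑-- (λ u → + e * (y u * δ u w)) (λ u → y u * A u w) ⟩
      ∑ (λ u → + e * (y u * δ u w)) - ∑ (λ u → y u * A u w)
        ≡⟨ cong (_- ∑ (λ u → y u * A u w)) (trans (∑-*ˡ (+ e) (λ u → y u * δ u w)) (cong (_*_ (+ e)) (∑-δʳ w y))) ⟩
      + e * y w - ∑ (λ u → y u * A u w)                   ∎)
      where
      open ≡-Reasoning
      expand : ∀ a e d r → a * (e * d - r) ≡ e * (a * d) - a * r
      expand = solve-∀
    regroup : ∀ w → + e * (+ (e ℕ.^ k) * x w - y w) + (+ e * y w - ∑ (λ u → y u * A u w))
                    ≡ + (e ℕ.^ suc k) * x w - (x ·A^ suc k) w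
    regroup w = trans (collect (+ e) (+ (e ℕ.^ k)) (x w) (y w) (∑ (λ u → y u * A u w)))
                      (cong₂ (λ a b → a * x w - b) (sym (ℤ.pos-* e (e ℕ.^ k))) (sym (·A^-suc x k w)))
      where collect : ∀ e E x y M → e * (E * x - y) + (e * y - M) ≡ e * E * x - M
            collect = solve-∀

-- Digraphs on ℤ/nℤ whose arcs leave v towards the e consecutive vertices
-- D·v + B, …, D·v + B + e − 1, and such that the out-intervals of L
-- consecutive vertices a, …, a + L − 1 tile one interval of length L·e
-- starting at D·a + c L.  Both DB(n,e) and Ktz(n,e) are of this kind.
module IntervalGraph (n : ℕ) .{{_ : NonZero n}} (e : ℕ) (arc : Fin n → Fin e → Fin n)
  (D B : ℤ) (c : ℕ → ℤ)
  (arc-interval : ∀ v i → arc v i ≡ idx n (D * vtx v + B + + toℕ i))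
  (tiling : ∀ a L w → ∑ℕ L (λ j → Intervals.interval n (D * (a + + j) + B) e w)
                      ≡ Intervals.interval n (D * a + c L) (L ℕ.* e) w) where

  open Residues n
  open Intervals n
  open OutRegular e arc

  A-interval : ∀ u w → A u w ≡ interval (D * vtx u + B) e w
  A-interval u w = trans (∑-cong (λ i → cong (λ z → δ z w) (arc-interval u i)))
                         (∑ℕ≡∑ e (λ j → δ (idx n (D * vtx u + B + + j)) w))

  -- Every vertex has in-degree e too (the graph is Eulerian), so the
  -- columns of the Laplacian sum to 0.
  Δ-column-sum : ∀ w → ∑ (λ v → Δ v w) ≡ 0ℤ
  Δ-column-sum w = begin
    ∑ (λ v → + e * δ v w - A v w)                  ≡⟨ ∑-- (λ v → + e * δ v w) (λ v → A v w) ⟩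
    ∑ (λ v → + e * δ v w) - ∑ (λ v → A v w)        ≡⟨ cong₂ _-_ (trans (∑-*ˡ (+ e) (λ v → δ v w)) (cong (_*_ (+ e)) (∑-δ′ w))) in-degree ⟩
    + e * 1ℤ - + e * 1ℤ                            ≡⟨ ℤ.+-inverseʳ (+ e * 1ℤ) ⟩
    0ℤ                                             ∎
    where
    open ≡-Reasoning
    in-degree : ∑ (λ v → A v w) ≡ + e * 1ℤ
    in-degree = begin
      ∑ (λ v → A v w)                               ≡⟨ ∑-cong (λ v → A-interval v w) ⟩
      ∑ {n} (λ v → interval (D * vtx v + B) e w)    ≡⟨ ∑ℕ≡∑ n (λ j → interval (D * + j + B) e w) ⟩
      ∑ℕ n (λ j → interval (D * + j + B) e w)       ≡⟨ tiling 0ℤ n w ⟩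
      interval (D * 0ℤ + c n) (n ℕ.* e) w           ≡⟨ cong (λ L → interval (D * 0ℤ + c n) L w) (ℕ.*-comm n e) ⟩
      interval (D * 0ℤ + c n) (e ℕ.* n) w           ≡⟨ interval-multiple (D * 0ℤ + c n) e w ⟩
      + e                                           ≡⟨ sym (ℤ.*-identityʳ (+ e)) ⟩
      + e * 1ℤ                                      ∎

  -- The walks of length k out of an integer a end in an interval of
  -- length e^k starting at start k a.
  start : ℕ → ℤ → ℤ
  start zero    a = a
  start (suc k) a = D * start k a + c (e ℕ.^ k)

  walks-interval : ∀ k v w → walks k v w ≡ interval (start k (vtx v)) (e ℕ.^ k) w
  walks-interval zero    v w = sym (trans (interval-single (vtx v) w) (cong (λ u → δ u w) (idx-vtx v)))
  walks-interval (suc k) v w = begin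
    ∑ (λ u → walks k v u * A u w)                                   ≡⟨ ∑-cong (λ u → cong (_* A u w) (walks-interval k v u)) ⟩
    ∑ (λ u → ∑ℕ L (λ j → δ (idx n (a + + j)) u) * A u w)            ≡⟨ ∑-cong (λ u → sym (∑ℕ-*ʳ L (A u w) (λ j → δ (idx n (a + + j)) u))) ⟩
    ∑ (λ u → ∑ℕ L (λ j → δ (idx n (a + + j)) u * A u w))            ≡⟨ ∑-∑ℕ L (λ u j → δ (idx n (a + + j)) u * A u w) ⟩
    ∑ℕ L (λ j → ∑ (λ u → δ (idx n (a + + j)) u * A u w))            ≡⟨ ∑ℕ-cong L (λ j → ∑-δˡ (idx n (a + + j)) (λ u → A u w)) ⟩
    ∑ℕ L (λ j → A (idx n (a + + j)) w)                              ≡⟨ ∑ℕ-cong L (λ j → trans (A-interval _ w) (interval-cong e w (out-start j))) ⟩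
    ∑ℕ L (λ j → interval (D * (a + + j) + B) e w)                   ≡⟨ tiling a L w ⟩
    interval (D * a + c L) (L ℕ.* e) w                              ≡⟨ cong (λ l → interval (D * a + c L) l w) (ℕ.*-comm L e) ⟩
    interval (start (suc k) (vtx v)) (e ℕ.^ suc k) w                ∎
    where
    open ≡-Reasoning
    a = start k (vtx v)
    L = e ℕ.^ k
    out-start : ∀ j → D * vtx (idx n (a + + j)) + B ≡ₙ D * (a + + j) + B
    out-start j = ≡ₙ-+ (≡ₙ-* (≡ₙ-refl {D}) (vtx-idx (a + + j))) (≡ₙ-refl {B})

  start-affine : ∀ k a → start k a ≡ D ^ k * a + start k 0ℤ
  start-affine zero    a = sym (trans (ℤ.+-identityʳ (1ℤ * a)) (ℤ.*-identityˡ a))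
  start-affine (suc k) a = begin
    D * start k a + c L                        ≡⟨ cong (λ s → D * s + c L) (start-affine k a) ⟩
    D * (D ^ k * a + start k 0ℤ) + c L         ≡⟨ regroup D (D ^ k) a (start k 0ℤ) (c L) ⟩
    D * D ^ k * a + (D * start k 0ℤ + c L)     ∎
    where
    open ≡-Reasoning
    L = e ℕ.^ k
    regroup : ∀ D P a s t → D * (P * a + s) + t ≡ D * P * a + (D * s + t)
    regroup = solve-∀

  periodicity : ∀ k k′ → D ^ k ≡ₙ D ^ k′ → start k 0ℤ ≡ₙ start k′ 0ℤ → + (e ℕ.^ k′) ≡ₙ + (e ℕ.^ k) →
                ∀ z → ∑ z ≡ 0ℤ → ∀ w → (z ·A^ k′) w ≡ (z ·A^ k) w
  periodicity k k′ Dᵏ≡ start≡ (mod (divides T eᵏ′-eᵏ≡)) z ∑z≡0 w = begin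
    ∑ (λ v → z v * walks k′ v w)          ≡⟨ ∑-cong (λ v → cong (_*_ (z v)) (walks-shift v)) ⟩
    ∑ (λ v → z v * (walks k v w + T))     ≡⟨ ∑-cong (λ v → ℤ.*-distribˡ-+ (z v) (walks k v w) T) ⟩
    ∑ (λ v → z v * walks k v w + z v * T) ≡⟨ ∑-+ (λ v → z v * walks k v w) (λ v → z v * T) ⟩
    (z ·A^ k) w + ∑ (λ v → z v * T)       ≡⟨ cong (_+_ ((z ·A^ k) w)) (trans (∑-*ʳ T z) (trans (cong (_* T) ∑z≡0) (ℤ.*-zeroˡ T))) ⟩
    (z ·A^ k) w + 0ℤ                      ≡⟨ ℤ.+-identityʳ _ ⟩
    (z ·A^ k) w                           ∎
    where
    open ≡-Reasoning
    same-start : ∀ v → start k′ (vtx v) ≡ₙ start k (vtx v)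
    same-start v = subst₂ _≡ₙ_ (sym (start-affine k′ (vtx v))) (sym (start-affine k (vtx v)))
                     (≡ₙ-+ (≡ₙ-* (≡ₙ-sym Dᵏ≡) ≡ₙ-refl) (≡ₙ-sym start≡))
    walks-shift : ∀ v → walks k′ v w ≡ walks k v w + T
    walks-shift v = begin
      walks k′ v w                                          ≡⟨ walks-interval k′ v w ⟩
      interval (start k′ (vtx v)) (e ℕ.^ k′) w              ≡⟨ interval-length (start k′ (vtx v)) (e ℕ.^ k) (e ℕ.^ k′) T w eᵏ′-eᵏ≡ ⟩
      interval (start k′ (vtx v)) (e ℕ.^ k) w + T           ≡⟨ cong (_+ T) (interval-cong (e ℕ.^ k) w (same-start v)) ⟩
      interval (start k (vtx v)) (e ℕ.^ k) w + T            ≡⟨ cong (_+ T) (sym (walks-interval k v w)) ⟩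
      walks k v w + T                                       ∎

  fingerprint : ℕ → Fin (n ℕ.* (n ℕ.* n))
  fingerprint k = combine (idx n (D ^ k)) (combine (idx n (start k 0ℤ)) (idx n (+ (e ℕ.^ k))))

  same-fingerprint : ∀ k k′ → fingerprint k ≡ fingerprint k′ →
                     D ^ k ≡ₙ D ^ k′ × start k 0ℤ ≡ₙ start k′ 0ℤ × + (e ℕ.^ k′) ≡ₙ + (e ℕ.^ k)
  same-fingerprint k k′ same = idx-injective (proj₁ split) , idx-injective (proj₁ split′) , ≡ₙ-sym (idx-injective (proj₂ split′))
    where
    split = Fin.combine-injective (idx n (D ^ k)) (combine (idx n (start k 0ℤ)) (idx n (+ (e ℕ.^ k))))
                                  (idx n (D ^ k′)) (combine (idx n (start k′ 0ℤ)) (idx n (+ (e ℕ.^ k′)))) same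
    split′ = Fin.combine-injective (idx n (start k 0ℤ)) (idx n (+ (e ℕ.^ k)))
                                   (idx n (start k′ 0ℤ)) (idx n (+ (e ℕ.^ k′))) (proj₂ split)

  recurrence : ∃₂ λ k k′ → k ℕ.< k′ × fingerprint k ≡ fingerprint k′
  recurrence with Fin.pigeonhole (ℕ.n<1+n (n ℕ.* (n ℕ.* n))) (λ k → fingerprint (toℕ k))
  ... | i , j , i<j , same = toℕ i , toℕ j , i<j , same

  -- If the residues recur at exponents k < k′ and e ≥ 2, then every vector z
  -- with coordinate sum 0 is torsion: (e^k′ − e^k) z ≡ z A^k′ − z A^k = 0.
  recurrence⇒torsion : 2 ≤ e → ∀ k k′ → k ℕ.< k′ → D ^ k ≡ₙ D ^ k′ → start k 0ℤ ≡ₙ start k′ 0ℤ →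
                       + (e ℕ.^ k′) ≡ₙ + (e ℕ.^ k) → ∀ z → ∑ z ≡ 0ℤ → Torsion Δ z
  recurrence⇒torsion e≥2 k k′ k<k′ Dᵏ≡ start≡ eᵏ≡ z ∑z≡0 =
    N , ℕ.>-nonZero (ℕ.m<n⇒0<n∸m eᵏ<eᵏ′) ,
    span-resp Δ difference (span-⊖ Δ (telescope k′ z) (telescope k z))
    where
    eᵏ<eᵏ′ : e ℕ.^ k ℕ.< e ℕ.^ k′
    eᵏ<eᵏ′ = ℕ.^-monoʳ-< e e≥2 k<k′
    N = e ℕ.^ k′ ℕ.∸ e ℕ.^ k
    eᵏ′≡ : + (e ℕ.^ k′) ≡ + (e ℕ.^ k) + + N
    eᵏ′≡ = trans (cong +_ (sym (ℕ.m+[n∸m]≡n (ℕ.<⇒≤ eᵏ<eᵏ′)))) (ℤ.pos-+ (e ℕ.^ k) N)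
    difference : ∀ w → (+ (e ℕ.^ k′) * z w - (z ·A^ k′) w) - (+ (e ℕ.^ k) * z w - (z ·A^ k) w) ≡ + N * z w
    difference w = trans (cong₂ (λ a b → (a * z w - b) - (+ (e ℕ.^ k) * z w - (z ·A^ k) w))
                                eᵏ′≡ (periodicity k k′ Dᵏ≡ start≡ eᵏ≡ z ∑z≡0 w))
                         (cancel (+ (e ℕ.^ k)) (+ N) (z w) ((z ·A^ k) w))
      where cancel : ∀ E N x M → ((E + N) * x - M) - (E * x - M) ≡ N * x
            cancel = solve-∀

  -- Hence, if e ≥ 2, the torsion subgroup contains the whole sum-zero lattice.
  -- (The data are taken apart by projections: a with-abstraction over them
  -- would normalise the residue proofs inside idx.)
  sum-zero⇒torsion : 2 ≤ e → ∀ z → ∑ z ≡ 0ℤ → Torsion Δ z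
  sum-zero⇒torsion e≥2 = recurrence⇒torsion e≥2 k k′ k<k′ (proj₁ same) (proj₁ (proj₂ same)) (proj₂ (proj₂ same))
    where
    k = proj₁ recurrence
    k′ = proj₁ (proj₂ recurrence)
    k<k′ = proj₁ (proj₂ (proj₂ recurrence))
    same = same-fingerprint k k′ (proj₂ (proj₂ (proj₂ recurrence)))

-- Vectors of coordinate sum 0 in ℤⁿ, n = m + 1: for each vertex v they are
-- exactly the combinations of the differences e_u − e_v (u ≠ v); for
-- v = 0 these are the generators x^u − 1 of 𝒵_n.
module Augmentation (m : ℕ) where
  n = suc m
  open Residues n

  basisDiff : Fin n → Fin m → Vecℤ n
  basisDiff v j = δ (punchIn v j) ⊖ δ v

  basisDiff-sum : ∀ v j → ∑ (basisDiff v j) ≡ 0ℤ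
  basisDiff-sum v j = trans (∑-- (δ (punchIn v j)) (δ v)) (cong₂ _-_ (∑-δ (punchIn v j)) (∑-δ v))

  basisDiff-coords : ∀ v y j → lincomb (basisDiff v) y (punchIn v j) ≡ y j
  basisDiff-coords v y j = begin
    ∑ (λ i → y i * (δ (punchIn v i) (punchIn v j) - δ v (punchIn v j)))
      ≡⟨ ∑-cong (λ i → cong₂ (λ a b → y i * (a - b)) (δ-punchIn i) (δ-off (λ v≡ → Fin.punchInᵢ≢i v j (sym v≡)))) ⟩
    ∑ (λ i → y i * (δ i j + 0ℤ))
      ≡⟨ ∑-cong (λ i → cong (_*_ (y i)) (ℤ.+-identityʳ (δ i j))) ⟩
    ∑ (λ i → y i * δ i j)
      ≡⟨ ∑-δʳ j y ⟩
    y j ∎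
    where
    open ≡-Reasoning
    δ-punchIn : ∀ i → δ (punchIn v i) (punchIn v j) ≡ δ i j
    δ-punchIn i with i Fin.≟ j
    ... | yes refl = δ-diag (punchIn v i)
    ... | no  i≢j  = δ-off (λ eq → i≢j (Fin.punchIn-injective v i j eq))

  basisDiff-expansion : ∀ v x → ∑ x ≡ 0ℤ → ∀ w → lincomb (basisDiff v) (λ j → x (punchIn v j)) w ≡ x w
  basisDiff-expansion v x ∑x≡0 w = begin
    ∑ (λ j → x′ j * (δ (punchIn v j) w - δ v w))                  ≡⟨ ∑-cong (λ j → distrib (x′ j) (δ (punchIn v j) w) (δ v w)) ⟩
    ∑ (λ j → x′ j * δ (punchIn v j) w - x′ j * δ v w)             ≡⟨ ∑-- (λ j → x′ j * δ (punchIn v j) w) (λ j → x′ j * δ v w) ⟩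
    ∑ (λ j → x′ j * δ (punchIn v j) w) - ∑ (λ j → x′ j * δ v w)   ≡⟨ cong (_-_ (∑ (λ j → x′ j * δ (punchIn v j) w))) (∑-*ʳ (δ v w) x′) ⟩
    ∑ (λ j → x′ j * δ (punchIn v j) w) - ∑ x′ * δ v w             ≡⟨ solve-for (x w) (x v) (δ v w) _ (∑ x′) coordinate-w sum-zero ⟩
    x w                                                           ∎
    where
    open ≡-Reasoning
    x′ = λ j → x (punchIn v j)
    distrib : ∀ a b c → a * (b - c) ≡ a * b - a * c
    distrib = solve-∀
    coordinate-w : x v * δ v w + ∑ (λ j → x′ j * δ (punchIn v j) w) ≡ x w
    coordinate-w = trans (sym (∑-punchIn v (λ u → x u * δ u w))) (∑-δʳ w x)
    sum-zero : x v + ∑ x′ ≡ 0ℤ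
    sum-zero = trans (sym (∑-punchIn v x)) ∑x≡0
    solve-for : ∀ xw xv d a s → xv * d + a ≡ xw → xv + s ≡ 0ℤ → a - s * d ≡ xw
    solve-for xw xv d a s p q = begin
      a - s * d                          ≡⟨ regroup xv d a s ⟩
      (xv * d + a) - (xv + s) * d        ≡⟨ cong₂ (λ b t → b - t * d) p q ⟩
      xw - 0ℤ * d                        ≡⟨ drop xw d ⟩
      xw                                 ∎
      where
      regroup : ∀ xv d a s → a - s * d ≡ (xv * d + a) - (xv + s) * d
      regroup = solve-∀
      drop : ∀ xw d → xw - 0ℤ * d ≡ xw
      drop = solve-∀

  𝒵gen≡basisDiff : ∀ j w → 𝒵gen n j w ≡ basisDiff zero j w
  𝒵gen≡basisDiff j w = cong₂ (λ u u′ → δ u w - δ u′ w) (idx-vtx (suc j)) (idx-vtx zero)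

  ∈𝒵⇒sum-zero : ∀ {x} → InSpan (𝒵gen n) x → ∑ x ≡ 0ℤ
  ∈𝒵⇒sum-zero = span-sum-zero (𝒵gen n) (λ j → trans (∑-cong (𝒵gen≡basisDiff j)) (basisDiff-sum zero j))

  sum-zero⇒∈𝒵 : ∀ {x} → ∑ x ≡ 0ℤ → InSpan (𝒵gen n) x
  sum-zero⇒∈𝒵 {x} ∑x≡0 = (λ j → x (suc j)) , λ w → sym (begin
    lincomb (𝒵gen n) (λ j → x (suc j)) w       ≡⟨ ∑-cong (λ j → cong (_*_ (x (suc j))) (𝒵gen≡basisDiff j w)) ⟩
    lincomb (basisDiff zero) (λ j → x (suc j)) w ≡⟨ basisDiff-expansion zero x ∑x≡0 w ⟩
    x w                                         ∎)
    where open ≡-Reasoning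

Quotient𝒵 : ∀ {m} → (Fin m → Vecℤ (suc m)) → SubQuot (suc m)
Quotient𝒵 {m} rel = record { Sub = InSpan (𝒵gen (suc m)) ; nrel = m ; rel = rel }

module Presentation (m e : ℕ) (arc : Fin (suc m) → Fin e → Fin (suc m))
  (Δ-column-sum : ∀ w → ∑ (λ v → Laplacian e arc v w) ≡ 0ℤ)
  (sum-zero⇒torsion : ∀ z → ∑ z ≡ 0ℤ → Torsion (Laplacian e arc) z)
  (σ : ℤ) (σ²≡1 : σ * σ ≡ 1ℤ)
  (rel : Fin m → Vecℤ (suc m)) (rel≡σΔ : ∀ j w → rel j w ≡ σ * Laplacian e arc (suc j) w) where

  open Augmentation m
  open OutRegular e arc using (Δ; Δ-row-sum; torsion⇒sum-zero)

  -- Column sums vanish, so any one row of Δ is minus the sum of the others.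
  Δ-row-dependent : ∀ v w → Δ v w ≡ - ∑ (λ j → Δ (punchIn v j) w)
  Δ-row-dependent v w = solve-for (Δ v w) (∑ (λ j → Δ (punchIn v j) w))
                          (trans (sym (∑-punchIn v (λ u → Δ u w))) (Δ-column-sum w))
    where
    add-sub : ∀ a s → a ≡ (a + s) - s
    add-sub = solve-∀
    solve-for : ∀ a s → a + s ≡ 0ℤ → a ≡ - s
    solve-for a s a+s≡0 = trans (add-sub a s) (trans (cong (_- s) a+s≡0) (ℤ.+-identityˡ (- s)))

  rel⊆Δ : ∀ j → InSpan Δ (rel j)
  rel⊆Δ j = span-resp Δ (λ w → sym (rel≡σΔ j w)) (span-• Δ σ (span-gen Δ (suc j)))

  Δ⊆rel : ∀ u → InSpan rel (Δ u)
  Δ⊆rel zero    = span-resp rel (λ w → sym (Δ-row-dependent zero w))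
                    (span-neg rel (span-∑ rel (λ j → Δ (suc j)) (λ j → Δ⊆rel (suc j))))
  Δ⊆rel (suc j) = span-resp rel σrel≡Δ (span-• rel σ (span-gen rel j))
    where σrel≡Δ : ∀ w → σ * rel j w ≡ Δ (suc j) w
          σrel≡Δ w = trans (cong (_*_ σ) (rel≡σΔ j w))
                       (trans (sym (ℤ.*-assoc σ σ _)) (trans (cong (_* Δ (suc j) w) σ²≡1) (ℤ.*-identityˡ _)))

  torsion⇒𝒵 : ∀ {x} → Torsion Δ x → InSpan (𝒵gen n) x
  torsion⇒𝒵 t = sum-zero⇒∈𝒵 (torsion⇒sum-zero t)

  critical-iso : CriticalGroup e arc ≅ Quotient𝒵 rel
  critical-iso = record
    { to      = λ x _ → x
    ; to-Sub  = λ x t → torsion⇒𝒵 t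
    ; to-cong = λ x y _ _ → span-mono Δ rel Δ⊆rel
    ; to-hom  = λ x y _ _ _ → span-⊖-self rel (x ⊕ y)
    ; to-inj  = λ x y _ _ → span-mono rel Δ rel⊆Δ
    ; to-surj = λ z z∈𝒵 → z , sum-zero⇒torsion z (∈𝒵⇒sum-zero z∈𝒵) , span-⊖-self rel z
    }

  module Sandpile (v : Fin n) where

    Δᵥ : Fin m → Vecℤ m
    Δᵥ = ReducedLaplacian e arc v

    extend : Vecℤ m → Vecℤ n
    extend = lincomb (basisDiff v)

    restrict : Vecℤ n → Vecℤ m
    restrict x j = x (punchIn v j)

    -- The row of Δ at v restricts to minus the sum of the rows of Δᵥ; any
    -- other row of Δ restricts to a row of Δᵥ.
    restrict-Δ : ∀ u → InSpan Δᵥ (restrict (Δ u))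
    restrict-Δ u with v Fin.≟ u
    ... | yes refl = span-resp Δᵥ (λ j → sym (Δ-row-dependent v (punchIn v j)))
                       (span-neg Δᵥ (span-∑ Δᵥ Δᵥ (span-gen Δᵥ)))
    ... | no  v≢u  = span-resp Δᵥ (λ j → cong (λ u′ → Δ u′ (punchIn v j)) (Fin.punchIn-punchOut v≢u))
                       (span-gen Δᵥ (punchOut v≢u))

    restrict-span : ∀ {x} → InSpan Δ x → InSpan Δᵥ (restrict x)
    restrict-span x∈ = span-mono (λ u → restrict (Δ u)) Δᵥ restrict-Δ (span-restrict (punchIn v) Δ x∈)

    extend-Δᵥ : ∀ i → InSpan rel (extend (Δᵥ i))
    extend-Δᵥ i = span-resp rel (λ w → sym (basisDiff-expansion v (Δ (punchIn v i)) (Δ-row-sum (punchIn v i)) w))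
                    (Δ⊆rel (punchIn v i))

    extend-∈𝒵 : ∀ y → InSpan (𝒵gen n) (extend y)
    extend-∈𝒵 y = sum-zero⇒∈𝒵 (span-sum-zero (basisDiff v) (basisDiff-sum v) (y , λ _ → refl))

    restrict-torsion : ∀ {z} → InSpan (𝒵gen n) z → Torsion Δᵥ (restrict z)
    restrict-torsion {z} z∈𝒵 =
      let (N , N≢0 , Nz∈) = sum-zero⇒torsion z (∈𝒵⇒sum-zero z∈𝒵) in N , N≢0 , restrict-span Nz∈

    sandpile-iso : SandpileGroup e arc v ≅ Quotient𝒵 rel
    sandpile-iso = record
      { to      = λ y _ → extend y
      ; to-Sub  = λ y _ → extend-∈𝒵 y
      ; to-cong = λ y y′ _ _ y≈y′ → span-resp rel (lincomb-⊖ (basisDiff v) y y′)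
                                      (lincomb-span (basisDiff v) extend-Δᵥ y≈y′)
      ; to-hom  = λ y y′ _ _ _ → span-zero rel (λ w → trans (cong (_- (extend y w + extend y′ w)) (lincomb-+ (basisDiff v) y y′ w))
                                                          (ℤ.+-inverseʳ (extend y w + extend y′ w)))
      ; to-inj  = λ y y′ _ _ ext≈ → span-resp Δᵥ (λ j → cong₂ _-_ (basisDiff-coords v y j) (basisDiff-coords v y′ j))
                                      (restrict-span (span-mono rel Δ rel⊆Δ ext≈))
      ; to-surj = λ z z∈𝒵 → restrict z , restrict-torsion z∈𝒵 ,
                    span-zero rel (λ w → trans (cong (_- z w) (basisDiff-expansion v z (∈𝒵⇒sum-zero z∈𝒵) w)) (ℤ.+-inverseʳ (z w)))
      }

module DeBruijn (m e : ℕ) where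
  open Residues (suc m)
  open Intervals (suc m)

  arc-interval : ∀ v i → DB (suc m) e v i ≡ idx (suc m) (+ e * vtx v + 0ℤ + + toℕ i)
  arc-interval v i = cong (λ s → idx (suc m) (s + + toℕ i)) (sym (ℤ.+-identityʳ (+ e * vtx v)))

  tiling : ∀ a L w → ∑ℕ L (λ j → interval (+ e * (a + + j) + 0ℤ) e w) ≡ interval (+ e * a + 0ℤ) (L ℕ.* e) w
  tiling a L w = trans (∑ℕ-cong L (λ j → interval-cong e w (≡ₙ-reflexive (expand (+ e) a (+ j)))))
                       (blocks-ascending (+ e * a + 0ℤ) e L w)
    where expand : ∀ e a j → e * (a + j) + 0ℤ ≡ e * a + 0ℤ + e * j
          expand = solve-∀

  open IntervalGraph (suc m) e (DB (suc m) e) (+ e) 0ℤ (λ _ → 0ℤ) arc-interval tiling public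

  f≡Δ : ∀ j w → f (suc m) (+ e) (+ suc (toℕ j)) w ≡ 1ℤ * Laplacian e (DB (suc m) e) (suc j) w
  f≡Δ j w = trans (cong (λ u → + e * δ u w - ∑ (λ i → δ (DB (suc m) e (suc j) i) w)) (idx-vtx (suc j)))
                  (sym (ℤ.*-identityˡ _))

module Kautz (m k : ℕ) where
  e = suc k
  open Residues (suc m)
  open Intervals (suc m)

  arc-interval : ∀ v i → Ktz (suc m) e v i ≡ idx (suc m) (- + e * vtx v + - + e + + toℕ i)
  arc-interval v i = cong (λ s → idx (suc m) (s + + toℕ i)) (expand (+ e) (vtx v))
    where expand : ∀ e v → - (e * (v + 1ℤ)) ≡ - e * v + - e
          expand = solve-∀

  tiling : ∀ a L w → ∑ℕ L (λ j → interval (- + e * (a + + j) + - + e) e w)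
                     ≡ interval (- + e * a + - + (L ℕ.* e)) (L ℕ.* e) w
  tiling a L w = begin
    ∑ℕ L (λ j → interval (- + e * (a + + j) + - + e) e w)
      ≡⟨ ∑ℕ-cong L (λ j → interval-cong e w (≡ₙ-reflexive (expand (+ e) a (+ j)))) ⟩
    ∑ℕ L (λ j → interval ((- + e * a + - + e) - + e * + j) e w)
      ≡⟨ blocks-descending (- + e * a + - + e) e L w ⟩
    interval ((- + e * a + - + e) + + e - + (L ℕ.* e)) (L ℕ.* e) w
      ≡⟨ interval-cong (L ℕ.* e) w (≡ₙ-reflexive (cancel (+ e) a (+ (L ℕ.* e)))) ⟩
    interval (- + e * a + - + (L ℕ.* e)) (L ℕ.* e) w ∎
    where
    open ≡-Reasoning
    expand : ∀ e a j → - e * (a + j) + - e ≡ (- e * a + - e) - e * j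
    expand = solve-∀
    cancel : ∀ e a l → (- e * a + - e) + e - l ≡ - e * a + - l
    cancel = solve-∀

  open IntervalGraph (suc m) e (Ktz (suc m) e) (- + e) (- + e) (λ L → - + (L ℕ.* e)) arc-interval tiling public

  f≡-Δ : ∀ j w → f (suc m) -[1+ k ] (+ suc (toℕ j)) w ≡ - 1ℤ * Laplacian e (Ktz (suc m) e) (suc j) w
  f≡-Δ j w = trans (cong₂ (λ u s → - + e * δ u w + s) (idx-vtx (suc j)) (∑-cong {e} (λ i → cong (λ a → δ (idx (suc m) (a + + toℕ i)) w)
                                                              (sym (ℤ.neg-distribˡ-* (+ e) (+ suc (toℕ j) + 1ℤ))))))
                   (negate (+ e) (δ (suc j) w) (∑ (λ i → δ (Ktz (suc m) e (suc j) i) w)))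
    where negate : ∀ e d s → - e * d + s ≡ - 1ℤ * (e * d - s)
          negate = solve-∀

corollary2p4 : (m : ℕ) (d : ℤ) → 2 ≤ ∣ d ∣ →
    (CriticalGroup (outdeg d) (Graph (suc m) d) ≅ PolyQuot (suc m) d)
    × ((v : Fin (suc m)) → SandpileGroup (outdeg d) (Graph (suc m) d) v ≅ PolyQuot (suc m) d)
corollary2p4 m (+ e) e≥2 = critical-iso , λ v → Sandpile.sandpile-iso v
  where
  open DeBruijn m e
  open Presentation m e (DB (suc m) e) Δ-column-sum (sum-zero⇒torsion e≥2)
                    1ℤ refl (λ j → f (suc m) (+ e) (+ suc (toℕ j))) f≡Δ
corollary2p4 m -[1+ k ] e≥2 = critical-iso , λ v → Sandpile.sandpile-iso v
  where
  open Kautz m k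
  open Presentation m (suc k) (Ktz (suc m) (suc k)) Δ-column-sum (sum-zero⇒torsion e≥2)
                    (- 1ℤ) refl (λ j → f (suc m) -[1+ k ] (+ suc (toℕ j))) f≡-Δ
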